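{- For every integer $n\geq 2$, $\Phi(G_n)=6\,\Phi(G_{n-1})-4\,\Phi(G_{n-2})$, where $\Phi(G_0)=1$ and $\Phi(G_1)=6$.
   Context: For a graph $G$, $\Phi(G)$ denotes the number of perfect matchings of $G$. For a positive integer $n$, $G_n$ is the plane graph (a polyomino graph with $4n$ unit square faces, a subgraph of the $4\times(2n+1)$ grid) with vertex set $\{u_0,v_0\}\cup\{u_i,v_i,w_i,z_i: 1\le i\le 2n\}$, drawn with $w_i$ at $(i,3)$, $u_i$ at $(i,2)$, $v_i$ at $(i,1)$, $z_i$ at $(i,0)$ (and $u_0$ at $(0,2)$, $v_0$ at $(0,1)$), and edge set consisting of: $u_{i-1}u_i$ and $v_{i-1}v_i$ for $1\le i\le 2n$; $u_iv_i$ for $0\le i\le 2n$; $w_iu_i$ and $v_iz_i$ for $1\le i\le 2n$; $w_{2j-1}w_{2j}$ and $z_{2j-1}z_{2j}$ for $1\le j\le n$. $G_0$ denotes the null graph (no vertices), which has exactly one (empty) perfect matching. -}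

module Defs where

open import Data.Nat using (ℕ; zero; suc; _+_; _*_; _≟_)
open import Data.Bool using (Bool; true; false; _∨_)
open import Data.List using (List; []; _∷_; _++_; map; concatMap; filter; length; upTo)
open import Data.List.Relation.Unary.All using (All; all?)
open import Data.Product using (_×_; _,_)
open import Relation.Nullary.Decidable using (⌊_⌋)
open import Relation.Binary.PropositionalEquality using (_≡_)

-- A finite (simple, undirected) graph: a list of distinct vertex labels and
-- a list of edges (unordered pairs of vertex labels, each edge listed once).
record Graph : Set where
  field
    vertices : List ℕ
    edges    : List (ℕ × ℕ)
open Graph public

-- All subsets of a list of m items, encoded as selection bit-strings of length m.
subsets : ℕ → List (List Bool)
subsets zero    = [] ∷ []
subsets (suc m) = map (true ∷_) (subsets m) ++ map (false ∷_) (subsets m)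

incident : ℕ → ℕ × ℕ → Bool
incident x (a , b) = ⌊ x ≟ a ⌋ ∨ ⌊ x ≟ b ⌋

degreeIn : List Bool → List (ℕ × ℕ) → ℕ → ℕ
degreeIn (true ∷ s)  (e ∷ es) x with incident x e
... | true  = suc (degreeIn s es x)
... | false = degreeIn s es x
degreeIn (false ∷ s) (e ∷ es) x = degreeIn s es x
degreeIn _ _ _ = 0

IsPerfectMatching : (G : Graph) → List Bool → Set
IsPerfectMatching G S = All (λ x → degreeIn S (edges G) x ≡ 1) (vertices G)

Φ : Graph → ℕ
Φ G = length (filter (λ S → all? (λ x → degreeIn S (edges G) x ≟ 1) (vertices G))
                     (subsets (length (edges G))))

u v w z : ℕ → ℕ
u i = 4 * i
v i = 4 * i + 1
w i = 4 * i + 2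
z i = 4 * i + 3

G : ℕ → Graph
G zero = record { vertices = [] ; edges = [] }
G (suc m) = record
  { vertices = u 0 ∷ v 0 ∷ concatMap (λ i → u i ∷ v i ∷ w i ∷ z i ∷ []) is
  ; edges    = (u 0 , v 0)
             ∷ concatMap (λ i → (u (i ∸' 1) , u i) ∷ (v (i ∸' 1) , v i) ∷ (u i , v i)
                                 ∷ (w i , u i) ∷ (v i , z i) ∷ []) is
            ++ concatMap (λ j → (w (2 * j + 1) , w (2 * j + 2))
                                 ∷ (z (2 * j + 1) , z (2 * j + 2)) ∷ []) (upTo n)
  }
  where
  n = suc m
  is : List ℕ
  is = map suc (upTo (2 * n))
  _∸'_ : ℕ → ℕ → ℕ
  zero ∸' _ = zero
  suc a ∸' zero = suc a
  suc a ∸' suc b = a ∸' b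

-- Φ counts the edge subsets S for which every vertex has degree 1, so it can be
-- computed edge by edge, threading the degree vector accumulated so far. The
-- edges of G_n are regrouped into blocks: block j joins column 2j to columns
-- 2j+1 and 2j+2. After the first j blocks every vertex left of column 2j is
-- settled, and the remaining count only depends on the degrees of u_{2j}, v_{2j}.
-- Only the states (0,0) and (1,1) survive; if p_j and q_j count them, one block
-- maps (p, q) to (p + q, p + 5q), a finite computation on block 0 that is
-- transported to block j by relabelling. Since Φ(G_n) = q_n, eliminating p gives
-- q_{j+2} = 6 q_{j+1} - 4 q_j.

module Submission where

open import Defs

module SubsetExpansion where

  open import Data.Nat using (ℕ; zero; suc; _+_; _*_; _≟_)
  open import Data.Nat.Properties
    using (+-identityʳ; +-suc; *-assoc; *-distribˡ-+; +-commutativeSemigroup; *-commutativeSemigroup)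
  open import Algebra.Properties.CommutativeSemigroup +-commutativeSemigroup
    using () renaming (interchange to +-interchange)
  open import Algebra.Properties.CommutativeSemigroup *-commutativeSemigroup
    using () renaming (x∙yz≈y∙xz to *-left-comm)
  open import Data.Bool using (Bool; true; false; _∧_; _∨_; if_then_else_)
  open import Data.List using (List; []; _∷_; _++_; map; filter; length)
  open import Data.List.Properties using (filter-++; length-++)
  open import Data.List.Relation.Unary.All as All using (All; []; _∷_; all?)
  open import Data.List.Relation.Unary.All.Properties using (map⁺)
  open import Data.List.Relation.Binary.Permutation.Propositional as Perm using (_↭_)
  open import Data.Product using (_×_; _,_; proj₁; proj₂) renaming (map to map×)
  open import Data.Unit using (⊤; tt)
  open import Function using (_∘_)
  open import Level using (0ℓ)
  open import Relation.Nullary using (¬_; does; yes; no; contradiction)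
  open import Relation.Nullary.Decidable using (isYes; isYes≗does)
  open import Relation.Unary using (Pred; Decidable)
  open import Relation.Binary.PropositionalEquality

  Edge : Set
  Edge = ℕ × ℕ

  Degrees : Set
  Degrees = ℕ → ℕ

  δ₁ : ℕ → ℕ
  δ₁ 1 = 1
  δ₁ _ = 0

  allOne : List ℕ → Degrees → ℕ
  allOne []      d = 1
  allOne (x ∷ V) d = δ₁ (d x) * allOne V d

  addEdge : Edge → Degrees → Degrees
  addEdge e d x = if incident x e then suc (d x) else d x

  sumSubsets : List Edge → (Degrees → ℕ) → Degrees → ℕ
  sumSubsets []      k d = k d
  sumSubsets (e ∷ E) k d = sumSubsets E k (addEdge e d) + sumSubsets E k d

  allOne-++ : ∀ A B d → allOne (A ++ B) d ≡ allOne A d * allOne B d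
  allOne-++ []      B d = sym (+-identityʳ (allOne B d))
  allOne-++ (x ∷ A) B d = trans (cong (δ₁ (d x) *_) (allOne-++ A B d)) (sym (*-assoc (δ₁ (d x)) _ _))

  allOne-map : ∀ f V d → allOne (map f V) d ≡ allOne V (d ∘ f)
  allOne-map f []      d = refl
  allOne-map f (x ∷ V) d = cong (δ₁ (d (f x)) *_) (allOne-map f V d)

  allOne-cong : ∀ {d d'} V → All (λ x → d x ≡ d' x) V → allOne V d ≡ allOne V d'
  allOne-cong []      []         = refl
  allOne-cong (x ∷ V) (eq ∷ eqs) = cong₂ _*_ (cong δ₁ eq) (allOne-cong V eqs)

  allOne-↭ : ∀ {V V'} d → V ↭ V' → allOne V d ≡ allOne V' d
  allOne-↭ d Perm.refl         = refl
  allOne-↭ d (Perm.prep x p)   = cong (δ₁ (d x) *_) (allOne-↭ d p)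
  allOne-↭ d (Perm.swap x y p) =
    trans (*-left-comm (δ₁ (d x)) (δ₁ (d y)) _) (cong (λ r → δ₁ (d y) * (δ₁ (d x) * r)) (allOne-↭ d p))
  allOne-↭ d (Perm.trans p q)  = trans (allOne-↭ d p) (allOne-↭ d q)

  allOne-all? : ∀ V d → (if does (all? (λ x → d x ≟ 1) V) then 1 else 0) ≡ allOne V d
  allOne-all? []      d = refl
  allOne-all? (x ∷ V) d with d x
  ... | zero        = refl
  ... | suc zero    = trans (allOne-all? V d) (sym (+-identityʳ (allOne V d)))
  ... | suc (suc _) = refl

  all?-cong : ∀ {f g : Degrees} V → (∀ x → f x ≡ g x) →
              does (all? (λ x → f x ≟ 1) V) ≡ does (all? (λ x → g x ≟ 1) V)
  all?-cong []      eq = refl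
  all?-cong (x ∷ V) eq = cong₂ _∧_ (cong (λ n → does (n ≟ 1)) (eq x)) (all?-cong V eq)

  module _ {A : Set} {P : Pred A 0ℓ} (P? : Decidable P) where

    length-filter-singleton : ∀ x → length (filter P? (x ∷ [])) ≡ (if does (P? x) then 1 else 0)
    length-filter-singleton x with does (P? x)
    ... | true  = refl
    ... | false = refl

    length-filter-map : ∀ {B : Set} {Q : Pred B 0ℓ} (Q? : Decidable Q) (f : B → A) →
                        (∀ x → does (P? (f x)) ≡ does (Q? x)) →
                        ∀ xs → length (filter P? (map f xs)) ≡ length (filter Q? xs)
    length-filter-map Q? f same []       = refl
    length-filter-map Q? f same (x ∷ xs) with does (P? (f x)) | does (Q? x) | same x
    ... | true  | true  | refl = cong suc (length-filter-map Q? f same xs)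
    ... | false | false | refl = length-filter-map Q? f same xs

  perfectOver? : (V : List ℕ) (E : List Edge) (d : Degrees) →
                 Decidable (λ S → All (λ x → d x + degreeIn S E x ≡ 1) V)
  perfectOver? V E d S = all? (λ x → d x + degreeIn S E x ≟ 1) V

  degreeIn-true : ∀ d e S E x → d x + degreeIn (true ∷ S) (e ∷ E) x ≡ addEdge e d x + degreeIn S E x
  degreeIn-true d e S E x with incident x e
  ... | true  = +-suc (d x) _
  ... | false = refl

  countPerfect≡sumSubsets : ∀ V E d →
    length (filter (perfectOver? V E d) (subsets (length E))) ≡ sumSubsets E (allOne V) d
  countPerfect≡sumSubsets V [] d = begin
    length (filter (perfectOver? V [] d) ([] ∷ []))
      ≡⟨ length-filter-singleton (perfectOver? V [] d) [] ⟩
    (if does (perfectOver? V [] d []) then 1 else 0)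
      ≡⟨ cong (λ b → if b then 1 else 0) (all?-cong V (λ x → +-identityʳ (d x))) ⟩
    (if does (all? (λ x → d x ≟ 1) V) then 1 else 0)
      ≡⟨ allOne-all? V d ⟩
    allOne V d ∎
    where open ≡-Reasoning
  countPerfect≡sumSubsets V (e ∷ E) d = begin
    length (filter P? (map (true ∷_) Ss ++ map (false ∷_) Ss))
      ≡⟨ cong length (filter-++ P? (map (true ∷_) Ss) _) ⟩
    length (filter P? (map (true ∷_) Ss) ++ filter P? (map (false ∷_) Ss))
      ≡⟨ length-++ (filter P? (map (true ∷_) Ss)) ⟩
    length (filter P? (map (true ∷_) Ss)) + length (filter P? (map (false ∷_) Ss))
      ≡⟨ cong₂ _+_ (length-filter-map P? (perfectOver? V E (addEdge e d)) (true ∷_)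
                                       (λ S → all?-cong V (degreeIn-true d e S E)) Ss)
                   (length-filter-map P? (perfectOver? V E d) (false ∷_) (λ _ → refl) Ss) ⟩
    length (filter (perfectOver? V E (addEdge e d)) Ss) + length (filter (perfectOver? V E d) Ss)
      ≡⟨ cong₂ _+_ (countPerfect≡sumSubsets V E (addEdge e d)) (countPerfect≡sumSubsets V E d) ⟩
    sumSubsets (e ∷ E) (allOne V) d ∎
    where
    open ≡-Reasoning
    Ss : List (List Bool)
    Ss = subsets (length E)
    P? : Decidable (λ S → All (λ x → d x + degreeIn S (e ∷ E) x ≡ 1) V)
    P? = perfectOver? V (e ∷ E) d

  Φ≡sumSubsets : ∀ H → Φ H ≡ sumSubsets (edges H) (allOne (vertices H)) (λ _ → 0)
  Φ≡sumSubsets H = countPerfect≡sumSubsets (vertices H) (edges H) (λ _ → 0)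

  DependsOn : Pred ℕ 0ℓ → (Degrees → ℕ) → Set
  DependsOn P k = ∀ {d d'} → (∀ {x} → P x → d x ≡ d' x) → k d ≡ k d'

  Extensional : (Degrees → ℕ) → Set
  Extensional = DependsOn (λ _ → ⊤)

  dependsOn⇒extensional : ∀ {P k} → DependsOn P k → Extensional k
  dependsOn⇒extensional k-dep eq = k-dep (λ _ → eq tt)

  allOne-extensional : ∀ V → Extensional (allOne V)
  allOne-extensional V eq = allOne-cong V (All.universal (λ _ → eq tt) V)

  addEdge-cong : ∀ {P : Pred ℕ 0ℓ} e {d d'} → (∀ {x} → P x → d x ≡ d' x) →
                 ∀ {x} → P x → addEdge e d x ≡ addEdge e d' x
  addEdge-cong e eq {x} px with incident x e
  ... | true  = cong suc (eq px)
  ... | false = eq px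

  sumSubsets-dependsOn : ∀ {P k} E → DependsOn P k → DependsOn P (sumSubsets E k)
  sumSubsets-dependsOn         []      k-dep eq = k-dep eq
  sumSubsets-dependsOn {P} (e ∷ E) k-dep eq =
    cong₂ _+_ (sumSubsets-dependsOn E k-dep (addEdge-cong {P} e eq)) (sumSubsets-dependsOn E k-dep eq)

  sumSubsets-cong : ∀ {k k'} E → (∀ d → k d ≡ k' d) → ∀ d → sumSubsets E k d ≡ sumSubsets E k' d
  sumSubsets-cong []      eq d = eq d
  sumSubsets-cong (e ∷ E) eq d = cong₂ _+_ (sumSubsets-cong E eq (addEdge e d)) (sumSubsets-cong E eq d)

  sumSubsets-++ : ∀ A B k d → sumSubsets (A ++ B) k d ≡ sumSubsets A (sumSubsets B k) d
  sumSubsets-++ []      B k d = refl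
  sumSubsets-++ (e ∷ A) B k d = cong₂ _+_ (sumSubsets-++ A B k (addEdge e d)) (sumSubsets-++ A B k d)

  sumSubsets-+ : ∀ E k k' d → sumSubsets E (λ d → k d + k' d) d ≡ sumSubsets E k d + sumSubsets E k' d
  sumSubsets-+ []      k k' d = refl
  sumSubsets-+ (e ∷ E) k k' d =
    trans (cong₂ _+_ (sumSubsets-+ E k k' (addEdge e d)) (sumSubsets-+ E k k' d))
          (+-interchange (sumSubsets E k (addEdge e d)) (sumSubsets E k' (addEdge e d)) _ _)

  sumSubsets-* : ∀ E c k d → sumSubsets E (λ d → c * k d) d ≡ c * sumSubsets E k d
  sumSubsets-* []      c k d = refl
  sumSubsets-* (e ∷ E) c k d =
    trans (cong₂ _+_ (sumSubsets-* E c k (addEdge e d)) (sumSubsets-* E c k d)) (sym (*-distribˡ-+ c _ _))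

  addEdge-comm : ∀ e e' d x → addEdge e (addEdge e' d) x ≡ addEdge e' (addEdge e d) x
  addEdge-comm e e' d x with incident x e | incident x e'
  ... | true  | true  = refl
  ... | true  | false = refl
  ... | false | true  = refl
  ... | false | false = refl

  sumSubsets-↭ : ∀ {k E E'} → Extensional k → E ↭ E' → ∀ d → sumSubsets E k d ≡ sumSubsets E' k d
  sumSubsets-↭ k-ext Perm.refl       d = refl
  sumSubsets-↭ k-ext (Perm.prep e p) d = cong₂ _+_ (sumSubsets-↭ k-ext p (addEdge e d)) (sumSubsets-↭ k-ext p d)
  sumSubsets-↭ {k} k-ext (Perm.swap {xs = E} {ys = E'} e e' p) d = begin
    (Σ (addEdge e' (addEdge e d)) + Σ (addEdge e d)) + (Σ (addEdge e' d) + Σ d)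
      ≡⟨ cong₂ _+_ (cong₂ _+_ (Σ≡Σ' _) (Σ≡Σ' _)) (cong₂ _+_ (Σ≡Σ' _) (Σ≡Σ' _)) ⟩
    (Σ' (addEdge e' (addEdge e d)) + Σ' (addEdge e d)) + (Σ' (addEdge e' d) + Σ' d)
      ≡⟨ cong (λ n → (n + Σ' (addEdge e d)) + (Σ' (addEdge e' d) + Σ' d))
              (sumSubsets-dependsOn E' k-ext (λ {x} _ → addEdge-comm e' e d x)) ⟩
    (Σ' (addEdge e (addEdge e' d)) + Σ' (addEdge e d)) + (Σ' (addEdge e' d) + Σ' d)
      ≡⟨ +-interchange (Σ' (addEdge e (addEdge e' d))) (Σ' (addEdge e d)) (Σ' (addEdge e' d)) (Σ' d) ⟩
    (Σ' (addEdge e (addEdge e' d)) + Σ' (addEdge e' d)) + (Σ' (addEdge e d) + Σ' d) ∎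
    where
    open ≡-Reasoning
    Σ Σ' : Degrees → ℕ
    Σ  = sumSubsets E k
    Σ' = sumSubsets E' k
    Σ≡Σ' : ∀ d → Σ d ≡ Σ' d
    Σ≡Σ' = sumSubsets-↭ k-ext p
  sumSubsets-↭ k-ext (Perm.trans p q) d = trans (sumSubsets-↭ k-ext p d) (sumSubsets-↭ k-ext q d)

  EndpointsIn : Pred ℕ 0ℓ → List Edge → Set
  EndpointsIn Q = All (λ e → Q (proj₁ e) × Q (proj₂ e))

  endpointsIn-mono : ∀ {Q Q' : Pred ℕ 0ℓ} {E} → (∀ {a} → Q a → Q' a) → EndpointsIn Q E → EndpointsIn Q' E
  endpointsIn-mono f = All.map (map× f f)

  Avoids : Pred ℕ 0ℓ → List Edge → Set
  Avoids P = EndpointsIn (λ y → ¬ P y)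

  incident-false : ∀ {x a b} → x ≢ a → x ≢ b → incident x (a , b) ≡ false
  incident-false {x} {a} {b} x≢a x≢b with x ≟ a | x ≟ b
  ... | yes x≡a | _       = contradiction x≡a x≢a
  ... | no _    | yes x≡b = contradiction x≡b x≢b
  ... | no _    | no _    = refl

  addEdge-outside : ∀ {P : Pred ℕ 0ℓ} {e} d → ¬ P (proj₁ e) × ¬ P (proj₂ e) →
                    ∀ {x} → P x → addEdge e d x ≡ d x
  addEdge-outside {P} d (¬Pa , ¬Pb) {x} px
    rewrite incident-false (λ x≡a → ¬Pa (subst P x≡a px)) (λ x≡b → ¬Pb (subst P x≡b px)) = refl

  sumSubsets-factor : ∀ {P} E U k d → Avoids P E → All P U →
                      sumSubsets E (λ d → allOne U d * k d) d ≡ allOne U d * sumSubsets E k d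
  sumSubsets-factor []      U k d avoids inU = refl
  sumSubsets-factor (e ∷ E) U k d (e-avoids ∷ avoids) inU = begin
    sumSubsets E (λ d → allOne U d * k d) (addEdge e d) + sumSubsets E (λ d → allOne U d * k d) d
      ≡⟨ cong₂ _+_ (sumSubsets-factor E U k (addEdge e d) avoids inU) (sumSubsets-factor E U k d avoids inU) ⟩
    allOne U (addEdge e d) * sumSubsets E k (addEdge e d) + allOne U d * sumSubsets E k d
      ≡⟨ cong (λ n → n * sumSubsets E k (addEdge e d) + allOne U d * sumSubsets E k d)
              (allOne-cong U (All.map (addEdge-outside d e-avoids) inU)) ⟩
    allOne U d * sumSubsets E k (addEdge e d) + allOne U d * sumSubsets E k d
      ≡⟨ sym (*-distribˡ-+ (allOne U d) _ _) ⟩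
    allOne U d * sumSubsets (e ∷ E) k d ∎
    where open ≡-Reasoning

  sumSubsets-local : ∀ {P} E k k' d → Avoids P E →
                     (∀ d' → (∀ {x} → P x → d' x ≡ d x) → k d' ≡ k' d') →
                     sumSubsets E k d ≡ sumSubsets E k' d
  sumSubsets-local []      k k' d avoids k≡k' = k≡k' d (λ _ → refl)
  sumSubsets-local (e ∷ E) k k' d (e-avoids ∷ avoids) k≡k' =
    cong₂ _+_ (sumSubsets-local E k k' (addEdge e d) avoids
                 (λ d' d'≡ → k≡k' d' (λ px → trans (d'≡ px) (addEdge-outside d e-avoids px))))
              (sumSubsets-local E k k' d avoids k≡k')

  shift : ℕ → Edge → Edge
  shift c (a , b) = c + a , c + b

  endpointsIn-shift : ∀ {Q Q' : Pred ℕ 0ℓ} {E} c → (∀ {a} → Q a → Q' (c + a)) →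
                      EndpointsIn Q E → EndpointsIn Q' (map (shift c) E)
  endpointsIn-shift c f qs = map⁺ (All.map (map× f f) qs)

  incident-shift : ∀ c x e → incident (c + x) (shift c e) ≡ incident x e
  incident-shift c x (a , b) = cong₂ _∨_ (isYes-shift a) (isYes-shift b)
    where
    does-shift : ∀ c y → does (c + x ≟ c + y) ≡ does (x ≟ y)
    does-shift zero    y = refl
    does-shift (suc c) y = does-shift c y
    isYes-shift : ∀ y → isYes (c + x ≟ c + y) ≡ isYes (x ≟ y)
    isYes-shift y = trans (isYes≗does _) (trans (does-shift c y) (sym (isYes≗does _)))

  addEdge-shift : ∀ c e d x → addEdge (shift c e) d (c + x) ≡ addEdge e (d ∘ (c +_)) x
  addEdge-shift c e d x rewrite incident-shift c x e = refl

  sumSubsets-shift : ∀ {k} c E → Extensional k → ∀ d →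
                     sumSubsets (map (shift c) E) (λ d → k (d ∘ (c +_))) d ≡ sumSubsets E k (d ∘ (c +_))
  sumSubsets-shift c []      k-ext d = refl
  sumSubsets-shift c (e ∷ E) k-ext d =
    cong₂ _+_ (trans (sumSubsets-shift c E k-ext (addEdge (shift c e) d))
                     (sumSubsets-dependsOn E k-ext (λ {x} _ → addEdge-shift c e d x)))
              (sumSubsets-shift c E k-ext d)

module LadderTransfer where

  open SubsetExpansion
  open import Data.Nat using (ℕ; zero; suc; pred; _+_; _*_; _≟_; _<_; _≤_; _<?_; z≤n; s≤s)
  open import Data.Nat.Properties
    using (+-comm; +-assoc; +-identityʳ; *-assoc; *-identityˡ; *-identityʳ; *-distribˡ-+; *-suc;
           +-cancelˡ-≡; m+n≮m; <⇒≱; +-monoʳ-≤; +-monoʳ-<; m≤m+n; ≤-trans; <-≤-trans; ≤-reflexive;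
           *-commutativeSemigroup)
  open import Algebra.Properties.CommutativeSemigroup *-commutativeSemigroup
    using () renaming (x∙yz≈y∙xz to *-left-comm)
  open import Data.Nat.Tactic.RingSolver using (solve-∀)
  open import Data.List using (List; []; _∷_; _++_; map; concatMap; upTo; applyUpTo)
  open import Data.List.Properties
    using (upTo-∷ʳ; ++-assoc; ++-identityʳ; map-++; concatMap-++; concatMap-map; concatMap-cong)
  open import Data.List.Relation.Unary.All as All using (All; []; _∷_; all?)
  open import Data.List.Relation.Unary.All.Properties using (++⁺; map⁺)
  open import Data.List.Relation.Binary.Permutation.Propositional as Perm
    using (_↭_; module PermutationReasoning)
  open import Data.List.Relation.Binary.Permutation.Propositional.Properties
    using (++⁺ˡ; ++⁺ʳ; ++-comm; shifts)
  open import Data.Product using (_×_; _,_; proj₁; proj₂)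
  open import Data.Sum using (_⊎_; inj₁; inj₂)
  open import Function using (_∘_)
  open import Relation.Nullary using (¬_; contradiction)
  open import Relation.Nullary.Decidable using (from-yes; _×-dec_; _⊎-dec_; ¬?)
  open import Relation.Unary using (Decidable)
  open import Relation.Binary.PropositionalEquality hiding (J)

  column : ℕ → List ℕ
  column i = u i ∷ v i ∷ w i ∷ z i ∷ []

  joinEdges : ℕ → List Edge
  joinEdges i = (u i , u (suc i)) ∷ (v i , v (suc i)) ∷ (u (suc i) , v (suc i))
              ∷ (w (suc i) , u (suc i)) ∷ (v (suc i) , z (suc i)) ∷ []

  outerEdges : ℕ → List Edge
  outerEdges j = (w (2 * j + 1) , w (2 * j + 2)) ∷ (z (2 * j + 1) , z (2 * j + 2)) ∷ []

  -- Opaque, so that a sum over the subsets of the concrete block 0 is never unfolded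
  -- symbolically during unification; it is only computed in transfer-δ00, transfer-δ11.
  opaque
    block : ℕ → List Edge
    block j = joinEdges (2 * j) ++ joinEdges (suc (2 * j)) ++ outerEdges j

  opaque
    unfolding block

    block-def : ∀ j → block j ≡ joinEdges (2 * j) ++ joinEdges (suc (2 * j)) ++ outerEdges j
    block-def j = refl

  ladderEdges : ℕ → List Edge
  ladderEdges zero    = (u 0 , v 0) ∷ []
  ladderEdges (suc j) = ladderEdges j ++ block j

  u-shift : ∀ i s → u (i + s) ≡ 4 * s + u i
  u-shift i s = trans (*-distribˡ-+ 4 i s) (+-comm (4 * i) (4 * s))

  label-shift : ∀ r i s → u (i + s) + r ≡ 4 * s + (u i + r)
  label-shift r i s = trans (cong (_+ r) (u-shift i s)) (+-assoc (4 * s) (u i) r)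

  column-shift : ∀ i s → column (i + s) ≡ map (4 * s +_) (column i)
  column-shift i s = cong₂ _∷_ (u-shift i s) (cong₂ _∷_ (label-shift 1 i s)
                     (cong₂ _∷_ (label-shift 2 i s) (cong₂ _∷_ (label-shift 3 i s) refl)))

  joinEdges-shift : ∀ i s → joinEdges (i + s) ≡ map (shift (4 * s)) (joinEdges i)
  joinEdges-shift i s =
    cong₂ _∷_ (cong₂ _,_ (u-shift i s) (u-shift (suc i) s))
    (cong₂ _∷_ (cong₂ _,_ (label-shift 1 i s) (label-shift 1 (suc i) s))
    (cong₂ _∷_ (cong₂ _,_ (u-shift (suc i) s) (label-shift 1 (suc i) s))
    (cong₂ _∷_ (cong₂ _,_ (label-shift 2 (suc i) s) (u-shift (suc i) s))
    (cong₂ _∷_ (cong₂ _,_ (label-shift 1 (suc i) s) (label-shift 3 (suc i) s)) refl))))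

  outerEdges-shift : ∀ j → outerEdges j ≡ map (shift (u (2 * j))) (outerEdges 0)
  outerEdges-shift j rewrite +-comm (2 * j) 1 | +-comm (2 * j) 2 =
    cong₂ _∷_ (cong₂ _,_ (label-shift 2 1 (2 * j)) (label-shift 2 2 (2 * j)))
    (cong₂ _∷_ (cong₂ _,_ (label-shift 3 1 (2 * j)) (label-shift 3 2 (2 * j))) refl)

  block-shift : ∀ j → block j ≡ map (shift (u (2 * j))) (block 0)
  block-shift j = begin
    block j
      ≡⟨ block-def j ⟩
    joinEdges (2 * j) ++ joinEdges (suc (2 * j)) ++ outerEdges j
      ≡⟨ cong₂ _++_ (joinEdges-shift 0 (2 * j)) (cong₂ _++_ (joinEdges-shift 1 (2 * j)) (outerEdges-shift j)) ⟩
    map (shift o) (joinEdges 0) ++ map (shift o) (joinEdges 1) ++ map (shift o) (outerEdges 0)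
      ≡⟨ sym (trans (map-++ (shift o) (joinEdges 0) _)
                    (cong (map (shift o) (joinEdges 0) ++_) (map-++ (shift o) (joinEdges 1) _))) ⟩
    map (shift o) (joinEdges 0 ++ joinEdges 1 ++ outerEdges 0)
      ≡⟨ cong (map (shift o)) (sym (block-def 0)) ⟩
    map (shift o) (block 0) ∎
    where
    open ≡-Reasoning
    o : ℕ
    o = u (2 * j)

  u-2*suc : ∀ j → u (2 * suc j) ≡ u (2 * j) + 8
  u-2*suc j = trans (cong u (*-suc 2 j)) (u-shift 2 (2 * j))

  upTo-2*suc : ∀ n → upTo (2 * suc n) ≡ upTo (2 * n) ++ 2 * n ∷ suc (2 * n) ∷ []
  upTo-2*suc n = begin
    upTo (2 * suc n)                                 ≡⟨ cong upTo (*-suc 2 n) ⟩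
    upTo (suc (suc (2 * n)))                         ≡⟨ sym (upTo-∷ʳ (suc (2 * n))) ⟩
    upTo (suc (2 * n)) ++ suc (2 * n) ∷ []           ≡⟨ cong (_++ suc (2 * n) ∷ []) (sym (upTo-∷ʳ (2 * n))) ⟩
    (upTo (2 * n) ++ 2 * n ∷ []) ++ suc (2 * n) ∷ [] ≡⟨ ++-assoc (upTo (2 * n)) (2 * n ∷ []) _ ⟩
    upTo (2 * n) ++ 2 * n ∷ suc (2 * n) ∷ []         ∎
    where open ≡-Reasoning

  -- The edge list of G (suc m) is only seen in normal form: the first column is split off,
  -- and the column edges use the truncated subtraction i ∸' 1 private to Defs, which only
  -- computes once i is a constructor.
  edges-G : ∀ m → edges (G (suc m))
                  ≡ (u 0 , v 0) ∷ concatMap joinEdges (upTo (2 * suc m)) ++ concatMap outerEdges (upTo (suc m))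
  edges-G m = cong (λ E → (u 0 , v 0) ∷ (joinEdges 0 ++ E) ++ concatMap outerEdges (upTo (suc m)))
    (concatMap-suc _ (λ { zero → refl ; (suc i) → refl }) (applyUpTo suc (pred (2 * suc m))))
    where
    concatMap-suc : ∀ (F : ℕ → List Edge) → (∀ i → F (suc i) ≡ joinEdges i) →
                    ∀ xs → concatMap F (map suc xs) ≡ concatMap joinEdges xs
    concatMap-suc F eq xs = trans (concatMap-map F suc xs) (concatMap-cong eq xs)

  ladderEdges-↭ : ∀ n → (u 0 , v 0) ∷ concatMap joinEdges (upTo (2 * n)) ++ concatMap outerEdges (upTo n)
                        ↭ ladderEdges n
  ladderEdges-↭ zero    = Perm.refl
  ladderEdges-↭ (suc n) = begin
    e₀ ∷ concatMap joinEdges (upTo (2 * suc n)) ++ concatMap outerEdges (upTo (suc n))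
      ≡⟨ cong₂ (λ A B → e₀ ∷ A ++ B)
               (trans (cong (concatMap joinEdges) (upTo-2*suc n)) (concatMap-++ joinEdges (upTo (2 * n)) _))
               (trans (cong (concatMap outerEdges) (sym (upTo-∷ʳ n))) (concatMap-++ outerEdges (upTo n) _)) ⟩
    e₀ ∷ (J ++ J') ++ (O ++ O')
      ≡⟨ cong (e₀ ∷_) (++-assoc J J' (O ++ O')) ⟩
    e₀ ∷ J ++ J' ++ O ++ O'
      ↭⟨ Perm.prep e₀ (++⁺ˡ J (shifts J' O)) ⟩
    e₀ ∷ J ++ O ++ J' ++ O'
      ≡⟨ cong (e₀ ∷_) (sym (++-assoc J O (J' ++ O'))) ⟩
    (e₀ ∷ J ++ O) ++ J' ++ O'
      ↭⟨ ++⁺ʳ (J' ++ O') (ladderEdges-↭ n) ⟩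
    ladderEdges n ++ J' ++ O'
      ≡⟨ cong (ladderEdges n ++_) (trans (cong₂ _++_ (++-identityʳ J') (++-identityʳ O')) (sym (block-def n))) ⟩
    ladderEdges (suc n) ∎
    where
    open PermutationReasoning
    e₀ : Edge
    e₀ = (u 0 , v 0)
    J O J' O' : List Edge
    J  = concatMap joinEdges (upTo (2 * n))
    O  = concatMap outerEdges (upTo n)
    J' = joinEdges (2 * n) ++ joinEdges (suc (2 * n)) ++ []
    O' = outerEdges n ++ []

  ladderVertices : ℕ → List ℕ
  ladderVertices n = u 0 ∷ v 0 ∷ concatMap column (map suc (upTo (2 * n)))

  ladderVertices-columns : ∀ n → concatMap column (map suc (upTo (2 * suc n)))
    ≡ concatMap column (map suc (upTo (2 * n))) ++ map (u (2 * n) +_) (4 ∷ 5 ∷ 6 ∷ 7 ∷ 8 ∷ 9 ∷ 10 ∷ 11 ∷ [])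
  ladderVertices-columns n = begin
    concatMap column (map suc (upTo (2 * suc n)))
      ≡⟨ cong (concatMap column ∘ map suc) (upTo-2*suc n) ⟩
    concatMap column (map suc (upTo (2 * n) ++ 2 * n ∷ suc (2 * n) ∷ []))
      ≡⟨ cong (concatMap column) (map-++ suc (upTo (2 * n)) _) ⟩
    concatMap column (C ++ suc (2 * n) ∷ suc (suc (2 * n)) ∷ [])
      ≡⟨ concatMap-++ column C _ ⟩
    concatMap column C ++ column (suc (2 * n)) ++ column (suc (suc (2 * n))) ++ []
      ≡⟨ cong (concatMap column C ++_)
              (cong₂ _++_ (column-shift 1 (2 * n)) (cong (_++ []) (column-shift 2 (2 * n)))) ⟩
    concatMap column C ++ map (u (2 * n) +_) (4 ∷ 5 ∷ 6 ∷ 7 ∷ 8 ∷ 9 ∷ 10 ∷ 11 ∷ []) ∎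
    where
    open ≡-Reasoning
    C : List ℕ
    C = map suc (upTo (2 * n))

  Weight : Set
  Weight = ℕ → ℕ → ℕ

  δ₀ : ℕ → ℕ
  δ₀ 0 = 1
  δ₀ _ = 0

  δ00 δ11 : Weight
  δ00 a b = δ₀ a * δ₀ b
  δ11 a b = δ₁ a * δ₁ b

  -- Block j uses the labels u(2j) + a for a < 12; those with a ≠ 8, 9 (the next boundary
  -- u(2j+2), v(2j+2)) and a ≠ 2, 3 (w(2j), z(2j), which belong to block j - 1) are its interior.
  blockInterior : List ℕ
  blockInterior = 0 ∷ 1 ∷ 4 ∷ 5 ∷ 6 ∷ 7 ∷ 10 ∷ 11 ∷ []

  interior : ℕ → List ℕ
  interior zero    = []
  interior (suc j) = interior j ++ map (u (2 * j) +_) blockInterior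

  stateWeight : ℕ → Weight → Degrees → ℕ
  stateWeight j φ d = allOne (interior j) d * φ (d (u (2 * j))) (d (v (2 * j)))

  stateSum : ℕ → Weight → ℕ
  stateSum j φ = sumSubsets (ladderEdges j) (stateWeight j φ) (λ _ → 0)

  boundary : ℕ → ℕ → Degrees
  boundary a b 0 = a
  boundary a b 1 = b
  boundary a b _ = 0

  blockWeight : Weight → Degrees → ℕ
  blockWeight φ d = allOne blockInterior d * φ (d 8) (d 9)

  transfer : Weight → Weight
  transfer φ a b = sumSubsets (block 0) (blockWeight φ) (boundary a b)

  opaque
    unfolding block

    transfer-δ00 : ∀ a b → transfer δ00 a b ≡ δ00 a b + δ11 a b
    transfer-δ00 0             0             = refl
    transfer-δ00 0             1             = refl
    transfer-δ00 0             (suc (suc _)) = refl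
    transfer-δ00 1             0             = refl
    transfer-δ00 1             1             = refl
    transfer-δ00 1             (suc (suc _)) = refl
    transfer-δ00 (suc (suc _)) 0             = refl
    transfer-δ00 (suc (suc _)) 1             = refl
    transfer-δ00 (suc (suc _)) (suc (suc _)) = refl

    transfer-δ11 : ∀ a b → transfer δ11 a b ≡ δ00 a b + 5 * δ11 a b
    transfer-δ11 0             0             = refl
    transfer-δ11 0             1             = refl
    transfer-δ11 0             (suc (suc _)) = refl
    transfer-δ11 1             0             = refl
    transfer-δ11 1             1             = refl
    transfer-δ11 1             (suc (suc _)) = refl
    transfer-δ11 (suc (suc _)) 0             = refl
    transfer-δ11 (suc (suc _)) 1             = refl
    transfer-δ11 (suc (suc _)) (suc (suc _)) = refl

  OwnLabel : ℕ → Set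
  OwnLabel a = a < 12 × a ≢ 2 × a ≢ 3

  ownLabel? : Decidable OwnLabel
  ownLabel? a = a <? 12 ×-dec ¬? (a ≟ 2) ×-dec ¬? (a ≟ 3)

  opaque
    unfolding block

    block₀-ownLabels : EndpointsIn OwnLabel (block 0)
    block₀-ownLabels = from-yes (all? (λ e → ownLabel? (proj₁ e) ×-dec ownLabel? (proj₂ e)) (block 0))

  block-endpoints : ∀ {Q} j → (∀ {a} → OwnLabel a → Q (u (2 * j) + a)) → EndpointsIn Q (block j)
  block-endpoints {Q} j own⇒Q =
    subst (EndpointsIn Q) (sym (block-shift j)) (endpointsIn-shift (u (2 * j)) own⇒Q block₀-ownLabels)

  Settled : ℕ → ℕ → Set
  Settled j x = x < u (2 * j) ⊎ x ≡ u (2 * j) + 2 ⊎ x ≡ u (2 * j) + 3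

  block-avoids-settled : ∀ j → Avoids (Settled j) (block j)
  block-avoids-settled j = block-endpoints j unsettled
    where
    o : ℕ
    o = u (2 * j)
    unsettled : ∀ {a} → OwnLabel a → ¬ Settled j (o + a)
    unsettled {a} _             (inj₁ o+a<o)          = m+n≮m o a o+a<o
    unsettled {a} (_ , a≢2 , _) (inj₂ (inj₁ o+a≡o+2)) = a≢2 (+-cancelˡ-≡ o a 2 o+a≡o+2)
    unsettled {a} (_ , _ , a≢3) (inj₂ (inj₂ o+a≡o+3)) = a≢3 (+-cancelˡ-≡ o a 3 o+a≡o+3)

  interior-settled : ∀ j → All (Settled j) (interior j)
  interior-settled zero    = []
  interior-settled (suc j) =
    ++⁺ (All.map settled-later (interior-settled j)) (map⁺ (All.map settled-new blockInterior-cases))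
    where
    o : ℕ
    o = u (2 * j)
    blockInterior-cases : All (λ a → a < 8 ⊎ a ≡ 10 ⊎ a ≡ 11) blockInterior
    blockInterior-cases = from-yes (all? (λ a → a <? 8 ⊎-dec a ≟ 10 ⊎-dec a ≟ 11) blockInterior)
    settled-below : ∀ {x} → Settled j x → x < o + 4
    settled-below (inj₁ x<o)         = <-≤-trans x<o (m≤m+n o 4)
    settled-below (inj₂ (inj₁ refl)) = +-monoʳ-< o (s≤s (s≤s (s≤s z≤n)))
    settled-below (inj₂ (inj₂ refl)) = +-monoʳ-< o (s≤s (s≤s (s≤s (s≤s z≤n))))
    settled-later : ∀ {x} → Settled j x → Settled (suc j) x
    settled-later {x} s =
      inj₁ (subst (x <_) (sym (u-2*suc j)) (<-≤-trans (settled-below s) (+-monoʳ-≤ o (m≤m+n 4 4))))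
    settled-new : ∀ {a} → a < 8 ⊎ a ≡ 10 ⊎ a ≡ 11 → Settled (suc j) (o + a)
    settled-new {a} (inj₁ a<8)     = inj₁ (subst (o + a <_) (sym (u-2*suc j)) (+-monoʳ-< o a<8))
    settled-new (inj₂ (inj₁ refl)) = inj₂ (inj₁ (trans (sym (+-assoc o 8 2)) (cong (_+ 2) (sym (u-2*suc j)))))
    settled-new (inj₂ (inj₂ refl)) = inj₂ (inj₂ (trans (sym (+-assoc o 8 3)) (cong (_+ 3) (sym (u-2*suc j)))))

  ladderEdges-below : ∀ j → EndpointsIn (_< u (2 * j) + 4) (ladderEdges j)
  ladderEdges-below zero    = (s≤s z≤n , s≤s (s≤s z≤n)) ∷ []
  ladderEdges-below (suc j) =
    ++⁺ (endpointsIn-mono (λ x<o+4 → <-≤-trans x<o+4 (≤-trans (+-monoʳ-≤ o (m≤m+n 4 8))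
                                                              (≤-reflexive o+12≡o'+4)))
                          (ladderEdges-below j))
        (block-endpoints j (λ (a<12 , _) → <-≤-trans (+-monoʳ-< o a<12) (≤-reflexive o+12≡o'+4)))
    where
    o : ℕ
    o = u (2 * j)
    o+12≡o'+4 : o + 12 ≡ u (2 * suc j) + 4
    o+12≡o'+4 = trans (sym (+-assoc o 8 4)) (cong (_+ 4) (sym (u-2*suc j)))

  ladderEdges-avoids : ∀ j → Avoids (u (2 * j) + 4 ≤_) (ladderEdges j)
  ladderEdges-avoids j = endpointsIn-mono <⇒≱ (ladderEdges-below j)

  blockWeight-dependsOn : ∀ φ → DependsOn OwnLabel (blockWeight φ)
  blockWeight-dependsOn φ eq =
    cong₂ _*_ (allOne-cong blockInterior (All.map eq (from-yes (all? ownLabel? blockInterior))))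
              (cong₂ φ (eq (from-yes (ownLabel? 8))) (eq (from-yes (ownLabel? 9))))

  boundary-agrees : ∀ j d → (∀ {x} → u (2 * j) + 4 ≤ x → d x ≡ 0) →
                    ∀ {a} → OwnLabel a → d (u (2 * j) + a) ≡ boundary (d (u (2 * j))) (d (v (2 * j))) a
  boundary-agrees j d vanish {0}                       _             = cong d (+-identityʳ (u (2 * j)))
  boundary-agrees j d vanish {1}                       _             = refl
  boundary-agrees j d vanish {2}                       (_ , a≢2 , _) = contradiction refl a≢2
  boundary-agrees j d vanish {3}                       (_ , _ , a≢3) = contradiction refl a≢3
  boundary-agrees j d vanish {suc (suc (suc (suc k)))} _             = vanish (+-monoʳ-≤ (u (2 * j)) (m≤m+n 4 k))

  stateWeight-suc : ∀ j φ d →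
                    stateWeight (suc j) φ d ≡ allOne (interior j) d * blockWeight φ (d ∘ (u (2 * j) +_))
  stateWeight-suc j φ d = begin
    allOne (interior j ++ map (o +_) blockInterior) d * φ (d (u (2 * suc j))) (d (v (2 * suc j)))
      ≡⟨ cong₂ _*_ (trans (allOne-++ (interior j) _ d)
                          (cong (allOne (interior j) d *_) (allOne-map (o +_) blockInterior d)))
                   (cong₂ φ (cong d (u-2*suc j)) (cong d v-2*suc)) ⟩
    allOne (interior j) d * allOne blockInterior (d ∘ (o +_)) * φ (d (o + 8)) (d (o + 9))
      ≡⟨ *-assoc (allOne (interior j) d) _ _ ⟩
    allOne (interior j) d * blockWeight φ (d ∘ (o +_)) ∎
    where
    open ≡-Reasoning
    o : ℕ
    o = u (2 * j)
    v-2*suc : v (2 * suc j) ≡ o + 9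
    v-2*suc = trans (cong (_+ 1) (u-2*suc j)) (+-assoc o 8 1)

  block-step : ∀ j φ d → (∀ {x} → u (2 * j) + 4 ≤ x → d x ≡ 0) →
               sumSubsets (block j) (stateWeight (suc j) φ) d ≡ stateWeight j (transfer φ) d
  block-step j φ d vanish = begin
    sumSubsets (block j) (stateWeight (suc j) φ) d
      ≡⟨ sumSubsets-cong (block j) (stateWeight-suc j φ) d ⟩
    sumSubsets (block j) (λ d → I d * local d) d
      ≡⟨ sumSubsets-factor (block j) (interior j) local d (block-avoids-settled j) (interior-settled j) ⟩
    I d * sumSubsets (block j) local d
      ≡⟨ cong (λ E → I d * sumSubsets E local d) (block-shift j) ⟩
    I d * sumSubsets (map (shift o) (block 0)) local d
      ≡⟨ cong (I d *_) (sumSubsets-shift o (block 0) (dependsOn⇒extensional (blockWeight-dependsOn φ)) d) ⟩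
    I d * sumSubsets (block 0) (blockWeight φ) (d ∘ (o +_))
      ≡⟨ cong (I d *_) (sumSubsets-dependsOn (block 0) (blockWeight-dependsOn φ) (boundary-agrees j d vanish)) ⟩
    I d * transfer φ (d o) (d (v (2 * j))) ∎
    where
    open ≡-Reasoning
    o : ℕ
    o = u (2 * j)
    I local : Degrees → ℕ
    I = allOne (interior j)
    local d = blockWeight φ (d ∘ (o +_))

  stateSum-suc : ∀ j φ → stateSum (suc j) φ ≡ stateSum j (transfer φ)
  stateSum-suc j φ =
    trans (sumSubsets-++ (ladderEdges j) (block j) (stateWeight (suc j) φ) (λ _ → 0))
          (sumSubsets-local (ladderEdges j) _ _ (λ _ → 0) (ladderEdges-avoids j) (block-step j φ))

  allOne-blockLabels : ∀ e → allOne (0 ∷ 1 ∷ 4 ∷ 5 ∷ 6 ∷ 7 ∷ 8 ∷ 9 ∷ 10 ∷ 11 ∷ []) e ≡ blockWeight δ11 e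
  allOne-blockLabels e = begin
    allOne (0 ∷ 1 ∷ 4 ∷ 5 ∷ 6 ∷ 7 ∷ 8 ∷ 9 ∷ 10 ∷ 11 ∷ []) e
      ≡⟨ allOne-↭ e (++⁺ˡ (0 ∷ 1 ∷ 4 ∷ 5 ∷ 6 ∷ 7 ∷ []) (++-comm (8 ∷ 9 ∷ []) (10 ∷ 11 ∷ []))) ⟩
    allOne (blockInterior ++ 8 ∷ 9 ∷ []) e
      ≡⟨ allOne-++ blockInterior (8 ∷ 9 ∷ []) e ⟩
    allOne blockInterior e * (δ₁ (e 8) * (δ₁ (e 9) * 1))
      ≡⟨ cong (λ n → allOne blockInterior e * (δ₁ (e 8) * n)) (*-identityʳ (δ₁ (e 9))) ⟩
    blockWeight δ11 e ∎
    where open ≡-Reasoning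

  allOne-ladderVertices : ∀ n d → allOne (ladderVertices n) d ≡ stateWeight n δ11 d
  allOne-ladderVertices zero    d = trans (cong (δ₁ (d 0) *_) (*-identityʳ (δ₁ (d 1)))) (sym (*-identityˡ _))
  allOne-ladderVertices (suc n) d = begin
    allOne (ladderVertices (suc n)) d
      ≡⟨ cong (λ V → allOne (u 0 ∷ v 0 ∷ V) d) (ladderVertices-columns n) ⟩
    allOne (ladderVertices n ++ map (o +_) L) d
      ≡⟨ allOne-++ (ladderVertices n) _ d ⟩
    allOne (ladderVertices n) d * allOne (map (o +_) L) d
      ≡⟨ cong₂ _*_ (allOne-ladderVertices n d) (allOne-map (o +_) L d) ⟩
    I * (δ₁ (d o) * δ₁ (e 1)) * allOne L e
      ≡⟨ *-assoc I _ _ ⟩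
    I * (δ₁ (d o) * δ₁ (e 1) * allOne L e)
      ≡⟨ cong (λ x → I * (δ₁ (d x) * δ₁ (e 1) * allOne L e)) (sym (+-identityʳ o)) ⟩
    I * (δ₁ (e 0) * δ₁ (e 1) * allOne L e)
      ≡⟨ cong (I *_) (trans (*-assoc (δ₁ (e 0)) _ _) (allOne-blockLabels e)) ⟩
    I * blockWeight δ11 e
      ≡⟨ sym (stateWeight-suc n δ11 d) ⟩
    stateWeight (suc n) δ11 d ∎
    where
    open ≡-Reasoning
    o I : ℕ
    o = u (2 * n)
    I = allOne (interior n) d
    e : Degrees
    e = d ∘ (o +_)
    L : List ℕ
    L = 4 ∷ 5 ∷ 6 ∷ 7 ∷ 8 ∷ 9 ∷ 10 ∷ 11 ∷ []

  Φ-G≡stateSum : ∀ n → Φ (G n) ≡ stateSum n δ11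
  Φ-G≡stateSum zero    = refl
  Φ-G≡stateSum (suc m) = begin
    Φ (G (suc m))
      ≡⟨ Φ≡sumSubsets (G (suc m)) ⟩
    sumSubsets (edges (G (suc m))) (allOne V) (λ _ → 0)
      ≡⟨ cong (λ E → sumSubsets E (allOne V) (λ _ → 0)) (edges-G m) ⟩
    sumSubsets ((u 0 , v 0) ∷ concatMap joinEdges (upTo (2 * suc m)) ++ concatMap outerEdges (upTo (suc m)))
               (allOne V) (λ _ → 0)
      ≡⟨ sumSubsets-↭ (allOne-extensional V) (ladderEdges-↭ (suc m)) (λ _ → 0) ⟩
    sumSubsets (ladderEdges (suc m)) (allOne V) (λ _ → 0)
      ≡⟨ sumSubsets-cong (ladderEdges (suc m)) (allOne-ladderVertices (suc m)) (λ _ → 0) ⟩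
    stateSum (suc m) δ11 ∎
    where
    open ≡-Reasoning
    V : List ℕ
    V = ladderVertices (suc m)

  stateSum-cong : ∀ j {φ ψ} → (∀ a b → φ a b ≡ ψ a b) → stateSum j φ ≡ stateSum j ψ
  stateSum-cong j φ≡ψ =
    sumSubsets-cong (ladderEdges j) (λ d → cong (allOne (interior j) d *_) (φ≡ψ _ _)) (λ _ → 0)

  stateSum-+ : ∀ j φ ψ → stateSum j (λ a b → φ a b + ψ a b) ≡ stateSum j φ + stateSum j ψ
  stateSum-+ j φ ψ =
    trans (sumSubsets-cong (ladderEdges j) (λ d → *-distribˡ-+ (allOne (interior j) d) _ _) (λ _ → 0))
          (sumSubsets-+ (ladderEdges j) (stateWeight j φ) (stateWeight j ψ) (λ _ → 0))

  stateSum-* : ∀ j c φ → stateSum j (λ a b → c * φ a b) ≡ c * stateSum j φ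
  stateSum-* j c φ =
    trans (sumSubsets-cong (ladderEdges j) (λ d → *-left-comm (allOne (interior j) d) c _) (λ _ → 0))
          (sumSubsets-* (ladderEdges j) c (stateWeight j φ) (λ _ → 0))

  stateSum-δ00-suc : ∀ j → stateSum (suc j) δ00 ≡ stateSum j δ00 + stateSum j δ11
  stateSum-δ00-suc j =
    trans (stateSum-suc j δ00) (trans (stateSum-cong j transfer-δ00) (stateSum-+ j δ00 δ11))

  stateSum-δ11-suc : ∀ j → stateSum (suc j) δ11 ≡ stateSum j δ00 + 5 * stateSum j δ11
  stateSum-δ11-suc j =
    trans (stateSum-suc j δ11)
    (trans (stateSum-cong j transfer-δ11)
    (trans (stateSum-+ j δ00 (λ a b → 5 * δ11 a b)) (cong (stateSum j δ00 +_) (stateSum-* j 5 δ11))))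

  stateSum-δ11-recurrence : ∀ j → stateSum (2 + j) δ11 + 4 * stateSum j δ11 ≡ 6 * stateSum (1 + j) δ11
  stateSum-δ11-recurrence j = begin
    q (2 + j) + 4 * q j
      ≡⟨ cong (_+ 4 * q j) (trans (stateSum-δ11-suc (suc j))
                                  (cong₂ _+_ (stateSum-δ00-suc j) (cong (5 *_) (stateSum-δ11-suc j)))) ⟩
    (p j + q j) + 5 * (p j + 5 * q j) + 4 * q j
      ≡⟨ eliminate-p (p j) (q j) ⟩
    6 * (p j + 5 * q j)
      ≡⟨ cong (6 *_) (sym (stateSum-δ11-suc j)) ⟩
    6 * q (1 + j) ∎
    where
    open ≡-Reasoning
    p q : ℕ → ℕ
    p j = stateSum j δ00
    q j = stateSum j δ11
    eliminate-p : ∀ x y → (x + y) + 5 * (x + 5 * y) + 4 * y ≡ 6 * (x + 5 * y)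
    eliminate-p = solve-∀

  Φ-G₁ : Φ (G 1) ≡ 6
  Φ-G₁ = trans (Φ-G≡stateSum 1) (stateSum-δ11-suc 0)

  Φ-G-recurrence : ∀ n → Φ (G (2 + n)) + 4 * Φ (G n) ≡ 6 * Φ (G (1 + n))
  Φ-G-recurrence n = begin
    Φ (G (2 + n)) + 4 * Φ (G n)
      ≡⟨ cong₂ (λ x y → x + 4 * y) (Φ-G≡stateSum (2 + n)) (Φ-G≡stateSum n) ⟩
    stateSum (2 + n) δ11 + 4 * stateSum n δ11
      ≡⟨ stateSum-δ11-recurrence n ⟩
    6 * stateSum (1 + n) δ11
      ≡⟨ cong (6 *_) (sym (Φ-G≡stateSum (1 + n))) ⟩
    6 * Φ (G (1 + n)) ∎
    where open ≡-Reasoning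

open LadderTransfer using (Φ-G₁; Φ-G-recurrence)
open import Data.Nat using (ℕ)
import Data.Nat as ℕ
import Data.Nat.Properties as ℕₚ
open import Data.Integer using (+_; _-_; _*_; _⊖_)
open import Data.Integer.Properties using (pos-*; m-n≡m⊖n; +-cancelˡ-⊖)
open import Data.Product using (_×_; _,_)
open import Relation.Binary.PropositionalEquality using (_≡_; refl; sym; trans; cong₂; module ≡-Reasoning)

recurrence-ℕ⇒ℤ : ∀ a b c → a ℕ.+ 4 ℕ.* c ≡ 6 ℕ.* b → + a ≡ + 6 * + b - + 4 * + c
recurrence-ℕ⇒ℤ a b c eq = sym (begin
  + 6 * + b - + 4 * + c                  ≡⟨ cong₂ _-_ (sym (pos-* 6 b)) (sym (pos-* 4 c)) ⟩
  + (6 ℕ.* b) - + (4 ℕ.* c)              ≡⟨ m-n≡m⊖n (6 ℕ.* b) (4 ℕ.* c) ⟩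
  6 ℕ.* b ⊖ 4 ℕ.* c                      ≡⟨ cong₂ _⊖_ (trans (sym eq) (ℕₚ.+-comm a (4 ℕ.* c)))
                                                      (sym (ℕₚ.+-identityʳ (4 ℕ.* c))) ⟩
  (4 ℕ.* c ℕ.+ a) ⊖ (4 ℕ.* c ℕ.+ 0)      ≡⟨ +-cancelˡ-⊖ (4 ℕ.* c) a 0 ⟩
  + a                                    ∎)
  where open ≡-Reasoning

lemma2p1 : (Φ (G 0) ≡ 1) × (Φ (G 1) ≡ 6)
           × ((n : ℕ) → + Φ (G (2 Data.Nat.+ n))
                          ≡ + 6 * + Φ (G (1 Data.Nat.+ n)) - + 4 * + Φ (G n))
lemma2p1 = refl , Φ-G₁ , λ n →
  recurrence-ℕ⇒ℤ (Φ (G (2 Data.Nat.+ n))) (Φ (G (1 Data.Nat.+ n))) (Φ (G n)) (Φ-G-recurrence n)
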